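{- Let $\mathscr{A}$ be a closed set of impartial games with misère quotient $(\mathcal{Q},\mathcal{P})$ and quotient map $\Phi$. Let $G$ be a game all of whose options lie in $\mathscr{A}$, and suppose $\Phi''H\subseteq\Phi''G\subseteq\mathcal{M}_x$ for some $H\in\mathscr{A}$ that is not identically $0$ (i.e. has at least one option) with $\Phi(H)=x$. Then $\mathcal{Q}(\mathrm{cl}(\mathscr{A}\cup\{G\}))\cong\mathcal{Q}(\mathscr{A})$ and $\Phi(G)=x$; precisely, with $\mathscr{B}=\mathrm{cl}(\mathscr{A}\cup\{G\})$: for $K,K'\in\mathscr{A}$, $K\equiv_{\mathscr{A}}K'$ iff $K\equiv_{\mathscr{B}}K'$, every element of $\mathscr{B}$ is $\equiv_{\mathscr{B}}$-equivalent to an element of $\mathscr{A}$, and $G\equiv_{\mathscr{B}}H'$ for every $H'\in\mathscr{A}$ with $\Phi(H')=x$.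
   Context: All games are impartial; $G+H$ is the disjunctive sum. In misère play the last player to move loses; $o^-(G)$ is the misère outcome. A set is closed if closed under sums and under taking options; $\mathrm{cl}(\mathscr{S})$ is the smallest closed superset. For closed $\mathscr{C}$, $K\equiv_{\mathscr{C}}K'$ iff $o^-(K+X)=o^-(K'+X)$ for all $X\in\mathscr{C}$; $\mathcal{Q}(\mathscr{C})$ is $(\mathscr{C}/\equiv_{\mathscr{C}},\text{classes of misère }\mathscr{P}\text{ -positions})$. $\Phi:\mathscr{A}\to\mathcal{Q}$ is the quotient map. For a game $G$ whose options lie in $\mathscr{A}$, $\Phi''G=\{\Phi(G'):G'\text{ an option of }G\}$. The meximal set of $x$ is $\mathcal{M}_x=\{y\in\mathcal{Q}:\text{no }w\in\mathcal{Q}\text{ has both }xw,yw\in\mathcal{P}\}$. -}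

module Defs where

open import Data.Nat using (ℕ; zero; suc; _+_)
open import Data.Fin using (Fin; zero; suc; splitAt)
open import Data.Bool using (Bool; true; false; not; _∧_)
open import Data.Sum using (_⊎_; inj₁; inj₂; [_,_]′)
open import Data.Empty using (⊥)
open import Data.Product using (Σ; _×_; ∃)
open import Relation.Binary.PropositionalEquality using (_≡_)

data Game : Set where
  mk : (n : ℕ) → (Fin n → Game) → Game

#opts : Game → ℕ
#opts (mk n _) = n

opt : (G : Game) → Fin (#opts G) → Game
opt (mk n f) i = f i

infixl 6 _⊕_
_⊕_ : Game → Game → Game
mk n f ⊕ mk m g =
  mk (n + m) (λ i → [ (λ j → f j ⊕ mk m g) , (λ k → mk n f ⊕ g k) ]′ (splitAt n i))

-- misère P-positions: true iff the player to move loses (last player to move loses).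
-- A game with no options is an N-position in misère play.
-- conjunction over a finite family of booleans
allFin : (n : ℕ) → (Fin n → Bool) → Bool
allFin zero    b = true
allFin (suc n) b = b zero ∧ allFin n (λ i → b (suc i))

isP : Game → Bool
isP (mk zero f)    = false
isP (mk (suc n) f) = allFin (suc n) (λ i → not (isP (f i)))

GameSet : Set₁
GameSet = Game → Set

record IsClosed (A : GameSet) : Set where
  field
    sum-closed : ∀ {X Y} → A X → A Y → A (X ⊕ Y)
    opt-closed : ∀ {X} → A X → (i : Fin (#opts X)) → A (opt X i)

data Cl (S : GameSet) : GameSet where
  base : ∀ {X} → S X → Cl S X
  sum  : ∀ {X Y} → Cl S X → Cl S Y → Cl S (X ⊕ Y)
  optn : ∀ {X} → Cl S X → (i : Fin (#opts X)) → Cl S (opt X i)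

_∪｛_｝ : GameSet → Game → GameSet
(A ∪｛ G ｝) X = A X ⊎ X ≡ G

_≡[_]_ : Game → GameSet → Game → Set
K ≡[ C ] K' = ∀ X → C X → isP (K ⊕ X) ≡ isP (K' ⊕ X)

-- Φ(Y) ∈ M_{Φ(H)} (meximal set), for Y, H ∈ A:
-- no w = Φ(W) ∈ Q(A) with both Φ(H)w and Φ(Y)w in 𝒫
InMeximal : GameSet → (H Y : Game) → Set
InMeximal A H Y = ∀ W → A W → (isP (H ⊕ W) ≡ true × isP (Y ⊕ W) ≡ true) → ⊥

{-# OPTIONS --safe #-}
-- Up to the order of options, every game of cl(A ∪ {G}) is n·G + a with a ∈ A, so everything
-- reduces to o⁻(n·G + a) = o⁻(n·H + a) for a ∈ A. The copies of G are exchanged for H one at a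
-- time, by strong induction on n and then induction on a, comparing G + X with H + X for
-- X = n·G + a: a move G → G′ cannot reach a 𝒫-position when H + X is one, because Φ(G′) ∈ 𝓜ₓ;
-- a move H → H′ is answered by a move to an equivalent G′, because Φ''H ⊆ Φ''G; and moves
-- inside X lead to positions covered by the induction hypotheses.
module Submission where

open import Defs
open import Data.Nat using (ℕ; zero; suc; _+_; _<_; s≤s)
open import Data.Nat.Properties using (≤-refl; ≤-reflexive; m≤n⇒m≤1+n)
open import Data.Nat.Induction using (<-rec)
open import Data.Fin using (Fin; zero; suc; fromℕ<; splitAt; _↑ˡ_; _↑ʳ_)
open import Data.Fin.Properties using (splitAt-↑ˡ; splitAt-↑ʳ)
open import Data.Bool using (true; false; not)
open import Data.Bool.Properties using (⇔→≡; ¬-not; not-¬; not-injective)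
open import Data.Sum using (inj₁; inj₂; [_,_]′)
open import Data.Product using (_×_; ∃-syntax; _,_; proj₁)
open import Function.Base using (_∘_)
open import Function.Bundles using (_⇔_; mk⇔)
open import Relation.Binary.Bundles using (Setoid)
import Relation.Binary.Reasoning.Setoid as SetoidReasoning
open import Relation.Binary.PropositionalEquality using (_≡_; refl; sym; trans; cong; subst; module ≡-Reasoning)

allFin-true⁻ : ∀ n b → allFin n b ≡ true → ∀ i → b i ≡ true
allFin-true⁻ (suc n) b all≡true i with b zero in b₀
allFin-true⁻ (suc n) b all≡true zero    | true = b₀
allFin-true⁻ (suc n) b all≡true (suc i) | true = allFin-true⁻ n _ all≡true i

allFin-true⁺ : ∀ n b → (∀ i → b i ≡ true) → allFin n b ≡ true
allFin-true⁺ zero    b _   = refl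
allFin-true⁺ (suc n) b all rewrite all zero = allFin-true⁺ n _ (λ i → all (suc i))

isP-true⇒opt : ∀ X → isP X ≡ true → Fin (#opts X)
isP-true⇒opt (mk (suc n) f) _ = zero

isP-true⁻ : ∀ X → isP X ≡ true → ∀ i → isP (opt X i) ≡ false
isP-true⁻ (mk (suc n) f) X∈𝒫 i = not-injective (allFin-true⁻ (suc n) (λ i → not (isP (f i))) X∈𝒫 i)

isP-true⁺ : ∀ X → Fin (#opts X) → (∀ i → isP (opt X i) ≡ false) → isP X ≡ true
isP-true⁺ (mk (suc n) f) _ opts = allFin-true⁺ (suc n) _ (λ i → cong not (opts i))

isP-cong-opts : ∀ X Y → (∀ i → ∃[ j ] isP (opt X i) ≡ isP (opt Y j)) →
                (∀ j → ∃[ i ] isP (opt X i) ≡ isP (opt Y j)) → isP X ≡ isP Y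
isP-cong-opts X Y fwd bwd = ⇔→≡ (mk⇔
  (P-transfer X Y (proj₁ ∘ fwd) (λ j → let (i , same) = bwd j in i , sym same))
  (P-transfer Y X (proj₁ ∘ bwd) fwd))
  where
  P-transfer : ∀ X Y → (Fin (#opts X) → Fin (#opts Y)) → (∀ j → ∃[ i ] isP (opt Y j) ≡ isP (opt X i)) →
               isP X ≡ true → isP Y ≡ true
  P-transfer X Y nonempty match X∈𝒫 = isP-true⁺ Y (nonempty (isP-true⇒opt X X∈𝒫))
    (λ j → let (i , same) = match j in trans same (isP-true⁻ X X∈𝒫 i))

opt-⊕-elim : ∀ (P : Game → Set) X Y → (∀ j → P (opt X j ⊕ Y)) → (∀ k → P (X ⊕ opt Y k)) →
             ∀ i → P (opt (X ⊕ Y) i)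
opt-⊕-elim P (mk n f) (mk m g) left right i with splitAt n i
... | inj₁ j = left j
... | inj₂ k = right k

∃opt-⊕ˡ : ∀ (P : Game → Set) X Y j → P (opt X j ⊕ Y) → ∃[ i ] P (opt (X ⊕ Y) i)
∃opt-⊕ˡ P (mk n f) (mk m g) j p = j ↑ˡ m , subst (λ s → P ([ _ , _ ]′ s)) (sym (splitAt-↑ˡ n j m)) p

∃opt-⊕ʳ : ∀ (P : Game → Set) X Y k → P (X ⊕ opt Y k) → ∃[ i ] P (opt (X ⊕ Y) i)
∃opt-⊕ʳ P (mk n f) (mk m g) k p = n ↑ʳ k , subst (λ s → P ([ _ , _ ]′ s)) (sym (splitAt-↑ʳ n m k)) p

∀opt-⊕ˡ : ∀ (P : Game → Set) X Y → (∀ i → P (opt (X ⊕ Y) i)) → ∀ j → P (opt X j ⊕ Y)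
∀opt-⊕ˡ P (mk n f) (mk m g) all j = subst (λ s → P ([ _ , _ ]′ s)) (splitAt-↑ˡ n j m) (all (j ↑ˡ m))

∀opt-⊕ʳ : ∀ (P : Game → Set) X Y → (∀ i → P (opt (X ⊕ Y) i)) → ∀ k → P (X ⊕ opt Y k)
∀opt-⊕ʳ P (mk n f) (mk m g) all k = subst (λ s → P ([ _ , _ ]′ s)) (splitAt-↑ʳ n m k) (all (n ↑ʳ k))

opt-index-⊕ˡ : ∀ X Y → Fin (#opts X) → Fin (#opts (X ⊕ Y))
opt-index-⊕ˡ (mk n f) (mk m g) j = j ↑ˡ m

isP-⊕-true⁺ : ∀ X Y → Fin (#opts X) → (∀ j → isP (opt X j ⊕ Y) ≡ false) →
              (∀ k → isP (X ⊕ opt Y k) ≡ false) → isP (X ⊕ Y) ≡ true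
isP-⊕-true⁺ X Y x₀ left right =
  isP-true⁺ (X ⊕ Y) (opt-index-⊕ˡ X Y x₀) (opt-⊕-elim (λ V → isP V ≡ false) X Y left right)

isP-⊕-true⁻ˡ : ∀ X Y → isP (X ⊕ Y) ≡ true → ∀ j → isP (opt X j ⊕ Y) ≡ false
isP-⊕-true⁻ˡ X Y XY∈𝒫 = ∀opt-⊕ˡ (λ V → isP V ≡ false) X Y (isP-true⁻ (X ⊕ Y) XY∈𝒫)

isP-⊕-true⁻ʳ : ∀ X Y → isP (X ⊕ Y) ≡ true → ∀ k → isP (X ⊕ opt Y k) ≡ false
isP-⊕-true⁻ʳ X Y XY∈𝒫 = ∀opt-⊕ʳ (λ V → isP V ≡ false) X Y (isP-true⁻ (X ⊕ Y) XY∈𝒫)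

isP-⊕-exchange : ∀ G H X → Fin (#opts G) → Fin (#opts H) →
  (isP (H ⊕ X) ≡ true → ∀ j → isP (opt G j ⊕ X) ≡ false) →
  (∀ i → isP (G ⊕ opt X i) ≡ isP (H ⊕ opt X i)) →
  (∀ i → isP (opt H i ⊕ X) ≡ true → ∃[ j ] isP (opt G j ⊕ X) ≡ true) →
  isP (G ⊕ X) ≡ isP (H ⊕ X)
isP-⊕-exchange G H X g₀ h₀ G′-avoids-𝒫 same-after-X-moves H′-matched = ⇔→≡ (mk⇔ GX⇒HX HX⇒GX)
  where
  GX⇒HX : isP (G ⊕ X) ≡ true → isP (H ⊕ X) ≡ true
  GX⇒HX GX∈𝒫 = isP-⊕-true⁺ H X h₀
    (λ i → ¬-not λ H′X∈𝒫 → let (j , G′X∈𝒫) = H′-matched i H′X∈𝒫 in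
                           not-¬ G′X∈𝒫 (isP-⊕-true⁻ˡ G X GX∈𝒫 j))
    (λ i → trans (sym (same-after-X-moves i)) (isP-⊕-true⁻ʳ G X GX∈𝒫 i))
  HX⇒GX : isP (H ⊕ X) ≡ true → isP (G ⊕ X) ≡ true
  HX⇒GX HX∈𝒫 = isP-⊕-true⁺ G X g₀ (G′-avoids-𝒫 HX∈𝒫)
    (λ i → trans (same-after-X-moves i) (isP-⊕-true⁻ʳ H X HX∈𝒫 i))

infix 4 _≅_ _≅∈_ _∋≅_

-- Games with the same hereditary set of options; ⊕ is commutative and associative only up to ≅.
data _≅_ : Game → Game → Set where
  ≅-intro : ∀ {X Y} → (∀ i → ∃[ j ] opt X i ≅ opt Y j) → (∀ j → ∃[ i ] opt X i ≅ opt Y j) → X ≅ Y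

_≅∈_ : Game → Game → Set
W ≅∈ X = ∃[ i ] W ≅ opt X i

_∋≅_ : Game → Game → Set
X ∋≅ W = ∃[ i ] opt X i ≅ W

≅-refl : ∀ {X} → X ≅ X
≅-refl {mk n f} = ≅-intro (λ i → i , ≅-refl {f i}) (λ i → i , ≅-refl {f i})

≅-sym : ∀ {X Y} → X ≅ Y → Y ≅ X
≅-sym (≅-intro fwd bwd) =
  ≅-intro (λ j → let (i , r) = bwd j in i , ≅-sym r) (λ i → let (j , r) = fwd i in j , ≅-sym r)

≅-trans : ∀ {X Y Z} → X ≅ Y → Y ≅ Z → X ≅ Z
≅-trans (≅-intro fwd bwd) (≅-intro fwd′ bwd′) =
  ≅-intro (λ i → let (j , r) = fwd i ; (k , r′) = fwd′ j in k , ≅-trans r r′)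
          (λ k → let (j , r′) = bwd′ k ; (i , r) = bwd j in i , ≅-trans r r′)

isP-cong : ∀ {X Y} → X ≅ Y → isP X ≡ isP Y
isP-cong {X} {Y} (≅-intro fwd bwd) =
  isP-cong-opts X Y (λ i → let (j , r) = fwd i in j , isP-cong r) (λ j → let (i , r) = bwd j in i , isP-cong r)

≅∈-⊕ˡ : ∀ {W} X Y j → W ≅ opt X j ⊕ Y → W ≅∈ X ⊕ Y
≅∈-⊕ˡ = ∃opt-⊕ˡ (_ ≅_)

≅∈-⊕ʳ : ∀ {W} X Y k → W ≅ X ⊕ opt Y k → W ≅∈ X ⊕ Y
≅∈-⊕ʳ = ∃opt-⊕ʳ (_ ≅_)

∋≅-⊕ˡ : ∀ {W} X Y j → opt X j ⊕ Y ≅ W → X ⊕ Y ∋≅ W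
∋≅-⊕ˡ = ∃opt-⊕ˡ (_≅ _)

∋≅-⊕ʳ : ∀ {W} X Y k → X ⊕ opt Y k ≅ W → X ⊕ Y ∋≅ W
∋≅-⊕ʳ = ∃opt-⊕ʳ (_≅ _)

⊕-cong : ∀ {X X′ Y Y′} → X ≅ X′ → Y ≅ Y′ → X ⊕ Y ≅ X′ ⊕ Y′
⊕-cong {X} {X′} {Y} {Y′} p@(≅-intro fwd bwd) q@(≅-intro fwd′ bwd′) = ≅-intro
  (opt-⊕-elim (_≅∈ X′ ⊕ Y′) X Y
     (λ j → let (j′ , r) = fwd j in ≅∈-⊕ˡ X′ Y′ j′ (⊕-cong r q))
     (λ k → let (k′ , r) = fwd′ k in ≅∈-⊕ʳ X′ Y′ k′ (⊕-cong p r)))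
  (opt-⊕-elim (X ⊕ Y ∋≅_) X′ Y′
     (λ j → let (j′ , r) = bwd j in ∋≅-⊕ˡ X Y j′ (⊕-cong r q))
     (λ k → let (k′ , r) = bwd′ k in ∋≅-⊕ʳ X Y k′ (⊕-cong p r)))

⊕-comm : ∀ X Y → X ⊕ Y ≅ Y ⊕ X
⊕-comm X@(mk _ f) Y@(mk _ g) = ≅-intro
  (opt-⊕-elim (_≅∈ Y ⊕ X) X Y
     (λ j → ≅∈-⊕ʳ Y X j (⊕-comm (f j) Y))
     (λ k → ≅∈-⊕ˡ Y X k (⊕-comm X (g k))))
  (opt-⊕-elim (X ⊕ Y ∋≅_) Y X
     (λ k → ∋≅-⊕ʳ X Y k (⊕-comm X (g k)))
     (λ j → ∋≅-⊕ˡ X Y j (⊕-comm (f j) Y)))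

⊕-assoc : ∀ X Y Z → (X ⊕ Y) ⊕ Z ≅ X ⊕ (Y ⊕ Z)
⊕-assoc X@(mk _ f) Y@(mk _ g) Z@(mk _ h) = ≅-intro
  (opt-⊕-elim (_≅∈ X ⊕ (Y ⊕ Z)) (X ⊕ Y) Z
     (opt-⊕-elim (λ V → V ⊕ Z ≅∈ X ⊕ (Y ⊕ Z)) X Y
        (λ a → ≅∈-⊕ˡ X (Y ⊕ Z) a (⊕-assoc (f a) Y Z))
        (λ b → ≅∈-⊕ʳ′ (⊕-assoc X (g b) Z) (≅∈-⊕ˡ Y Z b ≅-refl)))
     (λ c → ≅∈-⊕ʳ′ (⊕-assoc X Y (h c)) (≅∈-⊕ʳ Y Z c ≅-refl)))
  (opt-⊕-elim ((X ⊕ Y) ⊕ Z ∋≅_) X (Y ⊕ Z)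
     (λ a → ∋≅-⊕ˡ′ (⊕-assoc (f a) Y Z) (∋≅-⊕ˡ X Y a ≅-refl))
     (opt-⊕-elim (λ V → (X ⊕ Y) ⊕ Z ∋≅ X ⊕ V) Y Z
        (λ b → ∋≅-⊕ˡ′ (⊕-assoc X (g b) Z) (∋≅-⊕ʳ X Y b ≅-refl))
        (λ c → ∋≅-⊕ʳ (X ⊕ Y) Z c (⊕-assoc X Y (h c)))))
  where
  ≅∈-⊕ʳ′ : ∀ {W V X Y} → W ≅ X ⊕ V → V ≅∈ Y → W ≅∈ X ⊕ Y
  ≅∈-⊕ʳ′ {X = X} {Y} W≅ (k , r) = ≅∈-⊕ʳ X Y k (≅-trans W≅ (⊕-cong ≅-refl r))
  ∋≅-⊕ˡ′ : ∀ {W V X Y} → V ⊕ Y ≅ W → X ∋≅ V → X ⊕ Y ∋≅ W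
  ∋≅-⊕ˡ′ {X = X} {Y} ≅W (j , r) = ∋≅-⊕ˡ X Y j (≅-trans (⊕-cong r ≅-refl) ≅W)

⊕-identityʳ : ∀ X g → X ⊕ mk 0 g ≅ X
⊕-identityʳ X@(mk _ f) g = ≅-intro
  (opt-⊕-elim (_≅∈ X) X (mk 0 g) (λ j → j , ⊕-identityʳ (f j) g) (λ ()))
  (λ j → ∋≅-⊕ˡ X (mk 0 g) j (⊕-identityʳ (f j) g))

⊕-congˡ : ∀ Z {X Y} → X ≅ Y → Z ⊕ X ≅ Z ⊕ Y
⊕-congˡ Z = ⊕-cong (≅-refl {Z})

≅-setoid : Setoid _ _
≅-setoid = record { Carrier = Game ; _≈_ = _≅_
                  ; isEquivalence = record { refl = ≅-refl ; sym = ≅-sym ; trans = ≅-trans } }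

⊕-left-comm : ∀ X Y Z → X ⊕ (Y ⊕ Z) ≅ Y ⊕ (X ⊕ Z)
⊕-left-comm X Y Z = begin
  X ⊕ (Y ⊕ Z)  ≈⟨ ⊕-assoc X Y Z ⟨
  (X ⊕ Y) ⊕ Z  ≈⟨ ⊕-cong (⊕-comm X Y) ≅-refl ⟩
  (Y ⊕ X) ⊕ Z  ≈⟨ ⊕-assoc Y X Z ⟩
  Y ⊕ (X ⊕ Z)  ∎
  where open SetoidReasoning ≅-setoid

infix 7 _·_⊕_
_·_⊕_ : ℕ → Game → Game → Game
zero  · Y ⊕ a = a
suc n · Y ⊕ a = Y ⊕ (n · Y ⊕ a)

·⊕-shift : ∀ n Y Z a → Z ⊕ (n · Y ⊕ a) ≅ n · Y ⊕ (Z ⊕ a)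
·⊕-shift zero    Y Z a = ≅-refl
·⊕-shift (suc n) Y Z a = ≅-trans (⊕-left-comm Z Y (n · Y ⊕ a)) (⊕-congˡ Y (·⊕-shift n Y Z a))

·⊕-+ : ∀ n m Y a b → (n · Y ⊕ a) ⊕ (m · Y ⊕ b) ≅ (n + m) · Y ⊕ (a ⊕ b)
·⊕-+ zero    m Y a b = ·⊕-shift m Y a b
·⊕-+ (suc n) m Y a b = ≅-trans (⊕-assoc Y (n · Y ⊕ a) (m · Y ⊕ b)) (⊕-congˡ Y (·⊕-+ n m Y a b))

data ·⊕-Option (n : ℕ) (Y a V : Game) : Set where
  in-base : ∀ i → V ≅ n · Y ⊕ opt a i → ·⊕-Option n Y a V
  in-copy : ∀ {m} k → suc m ≡ n → V ≅ m · Y ⊕ (opt Y k ⊕ a) → ·⊕-Option n Y a V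

·⊕-opt : ∀ n Y a i → ·⊕-Option n Y a (opt (n · Y ⊕ a) i)
·⊕-opt zero    Y a i = in-base i ≅-refl
·⊕-opt (suc n) Y a = opt-⊕-elim (·⊕-Option (suc n) Y a) Y (n · Y ⊕ a)
  (λ k → in-copy k refl (·⊕-shift n Y (opt Y k) a))
  (λ i → Y⊕ (·⊕-opt n Y a i))
  where
  Y⊕ : ∀ {V} → ·⊕-Option n Y a V → ·⊕-Option (suc n) Y a (Y ⊕ V)
  Y⊕ (in-base i r)   = in-base i (⊕-congˡ Y r)
  Y⊕ (in-copy k e r) = in-copy k (cong suc e) (⊕-congˡ Y r)

zero∈closed : ∀ {A} → IsClosed A → ∀ {X} → A X → ∃[ g ] A (mk 0 g)
zero∈closed A-closed {mk zero    g} X∈A = g , X∈A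
zero∈closed A-closed {mk (suc n) f} X∈A = zero∈closed A-closed {f zero} (IsClosed.opt-closed A-closed X∈A zero)

·⊕-closed : ∀ {A} → IsClosed A → ∀ n {Y a} → A Y → A a → A (n · Y ⊕ a)
·⊕-closed A-closed zero    Y∈A a∈A = a∈A
·⊕-closed A-closed (suc n) Y∈A a∈A = IsClosed.sum-closed A-closed Y∈A (·⊕-closed A-closed n Y∈A a∈A)

≡[]-restrict : ∀ {C D : GameSet} → (∀ {X} → C X → D X) → ∀ {K K′} → K ≡[ D ] K′ → K ≡[ C ] K′
≡[]-restrict C⊆D K≡K′ X X∈C = K≡K′ X (C⊆D X∈C)

module Extension
  (A : GameSet) (A-closed : IsClosed A)
  (G : Game) (G-opts∈A : ∀ j → A (opt G j))
  (H : Game) (H∈A : A H) (H-nonempty : 0 < #opts H)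
  (H-opts⊆G-opts : ∀ i → ∃[ j ] (opt H i ≡[ A ] opt G j))
  (G-opts-meximal : ∀ j → InMeximal A H (opt G j))
  where

  open IsClosed A-closed

  B : GameSet
  B = Cl (A ∪｛ G ｝)

  Replaceable : ℕ → Set
  Replaceable n = ∀ a → A a → isP (n · G ⊕ a) ≡ isP (n · H ⊕ a)

  replace-under : ∀ n → Replaceable n → ∀ Y a → A Y → A a →
                  isP (Y ⊕ (n · G ⊕ a)) ≡ isP (Y ⊕ (n · H ⊕ a))
  replace-under n replace Y a Y∈A a∈A = begin
    isP (Y ⊕ (n · G ⊕ a))  ≡⟨ isP-cong (·⊕-shift n G Y a) ⟩
    isP (n · G ⊕ (Y ⊕ a))  ≡⟨ replace (Y ⊕ a) (sum-closed Y∈A a∈A) ⟩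
    isP (n · H ⊕ (Y ⊕ a))  ≡⟨ isP-cong (·⊕-shift n H Y a) ⟨
    isP (Y ⊕ (n · H ⊕ a))  ∎
    where open ≡-Reasoning

  h₀ : Fin (#opts H)
  h₀ = fromℕ< H-nonempty

  g₀ : Fin (#opts G)
  g₀ = proj₁ (H-opts⊆G-opts h₀)

  exchange : ∀ n → (∀ {m} → m < suc n → Replaceable m) →
             ∀ a → A a → isP (G ⊕ (n · G ⊕ a)) ≡ isP (H ⊕ (n · G ⊕ a))
  exchange n below a@(mk _ f) a∈A =
    isP-⊕-exchange G H X g₀ h₀ G′-avoids-𝒫 same-after-X-moves H′-matched
    where
    X W : Game
    X = n · G ⊕ a
    W = n · H ⊕ a
    W∈A : A W
    W∈A = ·⊕-closed A-closed n H∈A a∈A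
    replace-n : Replaceable n
    replace-n = below ≤-refl

    G′-avoids-𝒫 : isP (H ⊕ X) ≡ true → ∀ j → isP (opt G j ⊕ X) ≡ false
    G′-avoids-𝒫 HX∈𝒫 j = trans (replace-under n replace-n (opt G j) a (G-opts∈A j) a∈A)
      (¬-not λ G′W∈𝒫 → G-opts-meximal j W W∈A
        (trans (sym (replace-under n replace-n H a H∈A a∈A)) HX∈𝒫 , G′W∈𝒫))

    same-after-X-moves : ∀ i → isP (G ⊕ opt X i) ≡ isP (H ⊕ opt X i)
    same-after-X-moves i with ·⊕-opt n G a i
    ... | in-base i′ r = begin
      isP (G ⊕ opt X i)        ≡⟨ isP-cong (⊕-congˡ G r) ⟩
      isP (G ⊕ (n · G ⊕ f i′)) ≡⟨ exchange n below (f i′) (opt-closed a∈A i′) ⟩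
      isP (H ⊕ (n · G ⊕ f i′)) ≡⟨ isP-cong (⊕-congˡ H r) ⟨
      isP (H ⊕ opt X i)        ∎
      where open ≡-Reasoning
    ... | in-copy {m} k m+1≡n r = begin
      isP (G ⊕ opt X i)      ≡⟨ isP-cong (⊕-congˡ G r) ⟩
      isP (suc m · G ⊕ b)    ≡⟨ below (s≤s m<n) b b∈A ⟩
      isP (suc m · H ⊕ b)    ≡⟨ replace-under m (below (m≤n⇒m≤1+n m<n)) H b H∈A b∈A ⟨
      isP (H ⊕ (m · G ⊕ b))  ≡⟨ isP-cong (⊕-congˡ H r) ⟨
      isP (H ⊕ opt X i)      ∎
      where
      open ≡-Reasoning
      m<n : m < n
      m<n = ≤-reflexive m+1≡n
      b = opt G k ⊕ a
      b∈A : A b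
      b∈A = sum-closed (G-opts∈A k) a∈A

    H′-matched : ∀ i → isP (opt H i ⊕ X) ≡ true → ∃[ j ] isP (opt G j ⊕ X) ≡ true
    H′-matched i H′X∈𝒫 with H-opts⊆G-opts i
    ... | j , H′≡G′ = j , (begin
      isP (opt G j ⊕ X)  ≡⟨ replace-under n replace-n (opt G j) a (G-opts∈A j) a∈A ⟩
      isP (opt G j ⊕ W)  ≡⟨ H′≡G′ W W∈A ⟨
      isP (opt H i ⊕ W)  ≡⟨ replace-under n replace-n (opt H i) a (opt-closed H∈A i) a∈A ⟨
      isP (opt H i ⊕ X)  ≡⟨ H′X∈𝒫 ⟩
      true               ∎)
      where open ≡-Reasoning

  replaceable : ∀ n → Replaceable n
  replaceable = <-rec Replaceable λ where
    zero    _     a a∈A → refl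
    (suc n) below a a∈A →
      trans (exchange n below a a∈A) (replace-under n (below ≤-refl) H a H∈A a∈A)

  infix 4 _⇝_
  _⇝_ : Game → Game → Set
  X ⇝ K = ∃[ n ] ∃[ a ] (A a × X ≅ n · G ⊕ a × K ≅ n · H ⊕ a)

  ⇝-isP : ∀ {X K} → X ⇝ K → isP X ≡ isP K
  ⇝-isP (n , a , a∈A , X≅ , K≅) = trans (isP-cong X≅) (trans (replaceable n a a∈A) (sym (isP-cong K≅)))

  ⇝-refl : ∀ {K} → A K → K ⇝ K
  ⇝-refl {K} K∈A = 0 , K , K∈A , ≅-refl , ≅-refl

  G⇝H : G ⇝ H
  G⇝H = let (g , 0∈A) = zero∈closed A-closed H∈A in
    1 , mk 0 g , 0∈A , ≅-sym (⊕-identityʳ G g) , ≅-sym (⊕-identityʳ H g)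

  ⇝-⊕ : ∀ {X Y K L} → X ⇝ K → Y ⇝ L → X ⊕ Y ⇝ K ⊕ L
  ⇝-⊕ (n , a , a∈A , X≅ , K≅) (m , b , b∈A , Y≅ , L≅) =
    n + m , a ⊕ b , sum-closed a∈A b∈A ,
    ≅-trans (⊕-cong X≅ Y≅) (·⊕-+ n m G a b) , ≅-trans (⊕-cong K≅ L≅) (·⊕-+ n m H a b)

  ⇝-opt : ∀ {X K} → X ⇝ K → ∀ i → ∃[ K′ ] (A K′ × opt X i ⇝ K′)
  ⇝-opt (n , a , a∈A , ≅-intro fwd _ , _) i with fwd i
  ... | j , r with ·⊕-opt n G a j
  ... | in-base i′ r′ = (n · H ⊕ opt a i′) , ·⊕-closed A-closed n H∈A (opt-closed a∈A i′) ,
                        n , opt a i′ , opt-closed a∈A i′ , ≅-trans r r′ , ≅-refl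
  ... | in-copy {m} k _ r′ = (m · H ⊕ (opt G k ⊕ a)) , ·⊕-closed A-closed m H∈A b∈A ,
                             m , (opt G k ⊕ a) , b∈A , ≅-trans r r′ , ≅-refl
    where b∈A = sum-closed (G-opts∈A k) a∈A

  translate : ∀ {Y} → B Y → ∃[ K ] (A K × Y ⇝ K)
  translate (base (inj₁ Y∈A)) = _ , Y∈A , ⇝-refl Y∈A
  translate (base (inj₂ refl)) = H , H∈A , G⇝H
  translate (sum X∈B Y∈B) =
    let (K , K∈A , X⇝K) = translate X∈B ; (L , L∈A , Y⇝L) = translate Y∈B
    in K ⊕ L , sum-closed K∈A L∈A , ⇝-⊕ X⇝K Y⇝L
  translate (optn X∈B i) = let (_ , _ , X⇝K) = translate X∈B in ⇝-opt X⇝K i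

  ≡[A]⇒≡[B] : ∀ {K K′} → A K → A K′ → K ≡[ A ] K′ → K ≡[ B ] K′
  ≡[A]⇒≡[B] {K} {K′} K∈A K′∈A K≡K′ X X∈B with translate X∈B
  ... | L , L∈A , X⇝L = begin
    isP (K ⊕ X)   ≡⟨ ⇝-isP (⇝-⊕ (⇝-refl K∈A) X⇝L) ⟩
    isP (K ⊕ L)   ≡⟨ K≡K′ L L∈A ⟩
    isP (K′ ⊕ L)  ≡⟨ ⇝-isP (⇝-⊕ (⇝-refl K′∈A) X⇝L) ⟨
    isP (K′ ⊕ X)  ∎
    where open ≡-Reasoning

  ⇝⇒≡[B] : ∀ {Y K} → A K → Y ⇝ K → Y ≡[ B ] K
  ⇝⇒≡[B] K∈A Y⇝K X X∈B = let (_ , _ , X⇝L) = translate X∈B in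
    trans (⇝-isP (⇝-⊕ Y⇝K X⇝L)) (sym (⇝-isP (⇝-⊕ (⇝-refl K∈A) X⇝L)))

corollary5p8 : (A : GameSet) → IsClosed A →
    (G : Game) → (∀ (j : Fin (#opts G)) → A (opt G j)) →
    (H : Game) → A H → 0 < #opts H →
    -- Φ''H ⊆ Φ''G
    (∀ (i : Fin (#opts H)) → ∃[ j ] (opt H i ≡[ A ] opt G j)) →
    -- Φ''G ⊆ M_x, where x = Φ(H)
    (∀ (j : Fin (#opts G)) → InMeximal A H (opt G j)) →
    (((K K' : Game) → A K → A K' → (K ≡[ A ] K') ⇔ (K ≡[ Cl (A ∪｛ G ｝) ] K'))
     × ((Y : Game) → Cl (A ∪｛ G ｝) Y → ∃[ K ] (A K × (Y ≡[ Cl (A ∪｛ G ｝) ] K)))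
     × ((H' : Game) → A H' → H' ≡[ A ] H → G ≡[ Cl (A ∪｛ G ｝) ] H'))
corollary5p8 A A-closed G G-opts∈A H H∈A H-nonempty H-opts⊆G-opts G-opts-meximal =
    (λ K K′ K∈A K′∈A → mk⇔ (≡[A]⇒≡[B] K∈A K′∈A) (≡[]-restrict (base ∘ inj₁) {K} {K′}))
  , (λ Y Y∈B → let (K , K∈A , Y⇝K) = translate Y∈B in K , K∈A , ⇝⇒≡[B] K∈A Y⇝K)
  , λ H′ H′∈A H′≡H X X∈B →
      trans (⇝⇒≡[B] H∈A G⇝H X X∈B) (sym (≡[A]⇒≡[B] H′∈A H∈A H′≡H X X∈B))
  where open Extension A A-closed G G-opts∈A H H∈A H-nonempty H-opts⊆G-opts G-opts-meximal
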